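{- Let $\lambda\ge1$, $k\ge1$ and $1\le n_1\le\cdots\le n_k$ be integers, let $u$ be the largest index with $n_u=n_1$, and set $N=\prod_{i=2}^k n_i$ and $N'=\prod_{i=u+1}^k n_i$. Let $r=r_1\lambda N+r_2$ with integers $r_1\ge0$ and $r_2\in[\lambda N]$. If $ms_r(\lambda\mathcal{K}_{n_1,\ldots,n_k})=rn_1$, then $n_1^{u-1}\mid r_2$, or $r_2\ge1$ and \[ \left(\left\lfloor\frac{r_2}{n_1^{u-1}}\right\rfloor+1\right)\left\lfloor\frac{\lambda N}{r_2}\right\rfloor\le\lambda N'\le\left\lfloor\frac{r_2}{n_1^{u-1}}\right\rfloor\left(\left\lfloor\frac{\lambda N}{r_2}\right\rfloor+1\right). \]
   Context: A hypergraph $\mathcal{H}=(V,E)$ consists of a finite vertex set $V$ and a finite set $E$ of edges, each with an associated vertex set; parallel edges are allowed. $\lambda\mathcal{H}$ replaces each edge by $\lambda$ distinct parallel edges. $[n]=\{0,\ldots,n-1\}$. An ordering of $\mathcal{H}$ is a bijection $\ell:E\to[\varepsilon]$, $\varepsilon=|E|$. For a sequence $S=e_0,\ldots,e_{s-1}$ of (not necessarily distinct) edges, $\mathcal{H}(S)$ is the hypergraph whose edges are the terms of $S$ counted with multiplicity. $S$ is consecutive in $\ell$ if $\ell(e_i)\equiv\ell(e_0)+i\pmod\varepsilon$ for all $i$ and $\ell(e_0)\le(a+1)\varepsilon-s$, where $a\varepsilon\le s<(a+1)\varepsilon$. $ms_r(\ell)$ is the largest $s$ such that every sequence $S$ of $s$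 consecutive edges of $\ell$ has maximum degree $\Delta(\mathcal{H}(S))\le r$, and $ms_r(\mathcal{H})$ is its maximum over orderings. $\mathcal{K}_{n_1,\ldots,n_k}$ has vertex set a disjoint union of sets $N_1,\ldots,N_k$ with $|N_i|=n_i$ and exactly one edge for each $k$-set meeting every $N_i$ in exactly one vertex. -}

module Defs where

open import Data.Nat using (ℕ; zero; suc; _+_; _*_; _∸_; _≤_; _<_; _<ᵇ_; _/_)
open import Data.Fin using (Fin; toℕ) renaming (zero to fzero; suc to fsuc)
import Data.Fin as F
open import Data.Bool using (Bool; true; false; if_then_else_)
open import Data.Product using (Σ; _×_; _,_; ∃)
open import Data.Unit using (⊤)
open import Function.Bundles using (_⤖_; Bijection)
open import Relation.Binary.PropositionalEquality using (_≡_)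
open import Relation.Nullary using (does)

-- A hypergraph: a vertex type, an edge type (parallel edges = distinct
-- elements of Edge) and a decidable incidence relation "v ∈ e".
record Hypergraph : Set₁ where
  field
    Vtx  : Set
    Edge : Set
    inc  : Vtx → Edge → Bool

open Hypergraph public

blowup : ℕ → Hypergraph → Hypergraph
blowup lam H = record
  { Vtx  = Vtx H
  ; Edge = Edge H × Fin lam
  ; inc  = λ v ec → inc H v (Data.Product.proj₁ ec)
  }
  where import Data.Product

Choice : (m : ℕ) → (Fin m → ℕ) → Set
Choice zero    n = ⊤
Choice (suc m) n = Fin (n fzero) × Choice m (λ i → n (fsuc i))

pick : {m : ℕ} {n : Fin m → ℕ} → Choice m n → (i : Fin m) → Fin (n i)
pick {suc m} (j , c) fzero    = j
pick {suc m} (j , c) (fsuc i) = pick c i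

-- complete m-partite m-uniform hypergraph K_{n_0,…,n_{m-1}}:
-- vertices are pairs (part i , vertex j of N_i), one edge per choice.
K : (m : ℕ) → (Fin m → ℕ) → Hypergraph
K m n = record
  { Vtx  = Σ (Fin m) (λ i → Fin (n i))
  ; Edge = Choice m n
  ; inc  = λ v e → does (pick e (Data.Product.proj₁ v) F.≟ Data.Product.proj₂ v)
  }
  where import Data.Product

-- an ordering: a bijection ℓ : E → [ε]  (ε is then |E|)
Ordering : Hypergraph → Set
Ordering H = Σ ℕ (λ ε → Edge H ⤖ Fin ε)

ε-of : (H : Hypergraph) → Ordering H → ℕ
ε-of H (ε , _) = ε

ℓ-of : (H : Hypergraph) → (o : Ordering H) → Edge H → Fin (ε-of H o)
ℓ-of H (ε , b) = Bijection.to b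

count : (s : ℕ) → (Fin s → Bool) → ℕ
count zero    f = 0
count (suc s) f = (if f fzero then 1 else 0) + count s (λ i → f (fsuc i))

degree : (H : Hypergraph) (s : ℕ) → (Fin s → Edge H) → Vtx H → ℕ
degree H s e v = count s (λ i → inc H v (e i))

-- S = e_0,…,e_{s-1} is consecutive in ℓ:
--  ℓ(e_i) ≡ ℓ(e_0) + i (mod ε)  (as ℓ(e_i) < ε: ℓ(e_0)+i = q ε + ℓ(e_i) for some q)
--  and ℓ(e_0) ≤ (a+1)ε − s where aε ≤ s < (a+1)ε.
Consecutive : (H : Hypergraph) (o : Ordering H) (s : ℕ) → (Fin s → Edge H) → Set
Consecutive H o zero    e = ⊤
Consecutive H o (suc s) e =
  ((i : Fin (suc s)) → ∃ λ q →
      toℕ (ℓ-of H o (e fzero)) + toℕ i ≡ q * ε-of H o + toℕ (ℓ-of H o (e i)))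
  × ((a : ℕ) → a * ε-of H o ≤ suc s → suc s < suc a * ε-of H o →
      toℕ (ℓ-of H o (e fzero)) ≤ suc a * ε-of H o ∸ suc s)

GoodLen : (H : Hypergraph) → Ordering H → ℕ → ℕ → Set
GoodLen H o r s = (e : Fin s → Edge H) → Consecutive H o s e →
  (v : Vtx H) → degree H s e v ≤ r

-- ms_r(H) = m : m = max over orderings ℓ of ms_r(ℓ), where ms_r(ℓ) is the
-- largest s with GoodLen; i.e. m is the largest s good for some ordering.
MsEq : (H : Hypergraph) (r m : ℕ) → Set
MsEq H r m = Σ (Ordering H) (λ o → GoodLen H o r m)
  × ((o : Ordering H) (s : ℕ) → GoodLen H o r s → s ≤ m)

prod : (m : ℕ) → (Fin m → ℕ) → ℕ
prod zero    f = 1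
prod (suc m) f = f fzero * prod m (λ i → f (fsuc i))

-- floor division (divisor 0 gives 0; only used with positive divisors)
_div_ : ℕ → ℕ → ℕ
a div zero  = 0
a div suc b = a / suc b

-- Take an ordering of λK whose windows of s = r n₁ consecutive edges all have maximum degree ≤ r,
-- and write s = r₁ ε + d with ε = λ n₁ N edges and d = r₂ n₁. For a part N_i of size n₁ the degrees
-- of its vertices in a window add up to s = n₁ r, so each of them is exactly r. Sliding a window by
-- one position therefore removes and adds edges with the same i-th coordinate, i.e. the i-th
-- coordinates at positions t and t + s ≡ t + d (mod ε) agree: the first u coordinates of the ordering
-- are d-periodic. A prefix x of those coordinates occurs λN′ times in the ordering, and as
-- ε = q d + ρ with q = ⌊λN / r₂⌋ and ρ < d, periodicity gives λN′ = q c(x) + c′(x), where c(x) and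
-- c′(x) ≤ c(x) count its occurrences among the first d and the first ρ positions. The c(x) average
-- r₂ / n₁^{u-1}; if this is not an integer, some c(x) exceeds its floor and some c(x) does not, and
-- these two prefixes give the two inequalities.

module Submission where

open import Defs
open import Data.Nat using (ℕ; zero; suc; _+_; _*_; _∸_; _^_; _≤_; _<_; _<ᵇ_; _≤?_; _<?_;
  z≤n; s≤s; s≤s⁻¹; z<s; s<s; NonZero; >-nonZero; _/_; _%_)
open import Data.Nat.Properties hiding (_≟_)
open import Data.Nat.DivMod using (m≡m%n+[m/n]*n; m%n<n; m/n*n≤m; m<n⇒m%n≡m; [m+kn]%n≡m%n)
open import Data.Nat.Divisibility using (_∣_; _∣?_; divides; _∣0)
open import Data.Nat.Tactic.RingSolver using (solve-∀)
open import Data.Fin using (Fin; toℕ; fromℕ<; _↑ˡ_; _↑ʳ_; combine; _≟_) renaming (zero to fzero; suc to fsuc)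
open import Data.Fin.Properties using (*↔×; 1↔⊤; remQuot-combine; toℕ-fromℕ<; toℕ-injective; toℕ<n)
open import Data.Bool using (Bool; true; false; if_then_else_)
open import Data.Product using (∃; _×_; _,_; proj₁; proj₂)
open import Data.Product.Algebra using (×-comm)
open import Data.Product.Function.NonDependent.Propositional using (_×-↔_)
open import Data.Sum using (_⊎_; inj₁; inj₂)
open import Data.Unit using (tt)
open import Data.Empty using (⊥-elim)
open import Relation.Nullary using (¬_; does; yes; no)
open import Relation.Binary.PropositionalEquality
open import Function using (_∘_; case_of_; _↔_; _⤖_; Inverse)
open import Function.Properties.Bijection using (⤖⇒↔)
open import Function.Properties.Inverse using (↔-refl; ↔-sym; ↔-trans)
open import Algebra.Properties.CommutativeMonoid.Sum +-0-commutativeMonoid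
  using (sum; sum-syntax; sum-cong-≗; sum-replicate-zero; ∑-distrib-+; ∑-comm; sum-permute)

open Inverse using (from)

indicator : Bool → ℕ
indicator b = if b then 1 else 0

count≡sum : ∀ s (P : Fin s → Bool) → count s P ≡ ∑[ j < s ] indicator (P j)
count≡sum zero    P = refl
count≡sum (suc s) P = cong (indicator (P fzero) +_) (count≡sum s (P ∘ fsuc))

sum-const : ∀ a c → ∑[ _ < a ] c ≡ a * c
sum-const zero    c = refl
sum-const (suc a) c = cong (c +_) (sum-const a c)

sum-↑ : ∀ a b (h : Fin (a + b) → ℕ) → sum h ≡ sum (h ∘ (_↑ˡ b)) + sum (h ∘ (a ↑ʳ_))
sum-↑ zero    b h = refl
sum-↑ (suc a) b h = trans (cong (h fzero +_) (sum-↑ a b (h ∘ fsuc))) (sym (+-assoc (h fzero) _ _))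

sum-combine : ∀ a b (h : Fin (a * b) → ℕ) → sum h ≡ ∑[ i < a ] ∑[ j < b ] h (combine i j)
sum-combine zero    b h = refl
sum-combine (suc a) b h =
  trans (sum-↑ b (a * b) h) (cong (sum (h ∘ (_↑ˡ a * b)) +_) (sum-combine a b (h ∘ (b ↑ʳ_))))

sum-if-≟ : ∀ {a} (w : Fin a) X → ∑[ v < a ] (if does (w ≟ v) then X else 0) ≡ X
sum-if-≟ {suc a} fzero    X = trans (cong (X +_) (sum-replicate-zero a)) (+-identityʳ X)
sum-if-≟ {suc a} (fsuc w) X = sum-if-≟ w X

∑-count-≟ : ∀ {a} s (g : Fin s → Fin a) → ∑[ v < a ] count s (λ j → does (g j ≟ v)) ≡ s
∑-count-≟ {a} zero    g = sum-replicate-zero a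
∑-count-≟ {a} (suc s) g = begin
  ∑[ v < a ] (indicator (does (g fzero ≟ v)) + count s (λ j → does (g (fsuc j) ≟ v)))
    ≡⟨ ∑-distrib-+ (λ v → indicator (does (g fzero ≟ v)))
                   (λ v → count s (λ j → does (g (fsuc j) ≟ v))) ⟩
  ∑[ v < a ] indicator (does (g fzero ≟ v)) + ∑[ v < a ] count s (λ j → does (g (fsuc j) ≟ v))
    ≡⟨ cong₂ _+_ (sum-if-≟ (g fzero) 1) (∑-count-≟ s (g ∘ fsuc)) ⟩
  suc s ∎
  where open ≡-Reasoning

sum-≤ : ∀ {a} r (h : Fin a → ℕ) → (∀ v → h v ≤ r) → sum h ≤ a * r
sum-≤ {zero}  r h h≤r = z≤n
sum-≤ {suc a} r h h≤r = +-mono-≤ (h≤r fzero) (sum-≤ r (h ∘ fsuc) (h≤r ∘ fsuc))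

sum≡*⇒≡ : ∀ {a} r (h : Fin a → ℕ) → (∀ v → h v ≤ r) → sum h ≡ a * r → ∀ v → h v ≡ r
sum≡*⇒≡ {suc a} r h h≤r sum≡ = pointwise
  where
  rest≤ : sum (h ∘ fsuc) ≤ a * r
  rest≤ = sum-≤ r (h ∘ fsuc) (h≤r ∘ fsuc)
  head≡ : h fzero ≡ r
  head≡ = ≤-antisym (h≤r fzero)
    (+-cancelʳ-≤ (a * r) r (h fzero) (subst (_≤ h fzero + a * r) sum≡ (+-monoʳ-≤ (h fzero) rest≤)))
  pointwise : ∀ v → h v ≡ r
  pointwise fzero    = head≡
  pointwise (fsuc v) = sum≡*⇒≡ r (h ∘ fsuc) (h≤r ∘ fsuc)
    (+-cancelˡ-≡ r _ _ (trans (cong (_+ sum (h ∘ fsuc)) (sym head≡)) sum≡)) v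

sum>*⇒∃> : ∀ {a} c (h : Fin a → ℕ) → a * c < sum h → ∃ λ v → c < h v
sum>*⇒∃> {suc a} c h a*c<sum with c <? h fzero
... | yes c<h₀ = fzero , c<h₀
... | no  c≮h₀ with sum>*⇒∃> c (h ∘ fsuc)
                      (+-cancelˡ-< c _ _ (<-≤-trans a*c<sum (+-monoˡ-≤ _ (≮⇒≥ c≮h₀))))
...   | v , c<hv = fsuc v , c<hv

sum<*⇒∃< : ∀ {a} c (h : Fin a → ℕ) → sum h < a * c → ∃ λ v → h v < c
sum<*⇒∃< {suc a} c h sum<a*c with h fzero <? c
... | yes h₀<c = fzero , h₀<c
... | no  h₀≮c with sum<*⇒∃< c (h ∘ fsuc)
                      (+-cancelˡ-< c _ _ (≤-<-trans (+-monoˡ-≤ _ (≮⇒≥ h₀≮c)) sum<a*c))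
...   | v , hv<c = fsuc v , hv<c

sum-straddles-average : ∀ {a} .{{_ : NonZero a}} D R (h : Fin a → ℕ) →
  D * sum h ≡ a * R → ¬ D ∣ R → (∃ λ v → R div D < h v) × (∃ λ v → h v ≤ R div D)
sum-straddles-average {a} zero R h D*sum≡ D∤R =
  ⊥-elim (D∤R (subst (0 ∣_) (sym (*-cancelˡ-≡ R 0 a (trans (sym D*sum≡) (sym (*-zeroʳ a))))) (0 ∣0)))
sum-straddles-average {a} D@(suc _) R h D*sum≡ D∤R = above , below
  where
  q = R / D
  qD<R : q * D < R
  qD<R = ≤∧≢⇒< (m/n*n≤m R D) (λ qD≡R → D∤R (divides q (sym qD≡R)))
  R<[1+q]D : R < suc q * D
  R<[1+q]D = subst (_< suc q * D) (sym (m≡m%n+[m/n]*n R D)) (+-monoˡ-< (q * D) (m%n<n R D))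
  swap : ∀ x y z → x * (y * z) ≡ y * (z * x)
  swap = solve-∀
  above : ∃ λ v → q < h v
  above = sum>*⇒∃> q h (*-cancelˡ-< D _ _
    (subst₂ _<_ (sym (swap D a q)) (sym D*sum≡) (*-monoʳ-< a qD<R)))
  below : ∃ λ v → h v ≤ q
  below with sum<*⇒∃< (suc q) h (*-cancelˡ-< D _ _
    (subst₂ _<_ (sym D*sum≡) (sym (swap D a (suc q))) (*-monoʳ-< a R<[1+q]D)))
  ... | v , hv<1+q = v , s≤s⁻¹ hv<1+q

sumTo : ℕ → (ℕ → ℕ) → ℕ
sumTo s A = ∑[ j < s ] A (toℕ j)

sumTo-cong< : ∀ s {A B : ℕ → ℕ} → (∀ j → j < s → A j ≡ B j) → sumTo s A ≡ sumTo s B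
sumTo-cong< zero    A≡B = refl
sumTo-cong< (suc s) A≡B = cong₂ _+_ (A≡B 0 z<s) (sumTo-cong< s (λ j j<s → A≡B (suc j) (s<s j<s)))

sumTo-+ : ∀ s t A → sumTo (s + t) A ≡ sumTo s A + sumTo t (λ j → A (s + j))
sumTo-+ zero    t A = refl
sumTo-+ (suc s) t A = trans (cong (A 0 +_) (sumTo-+ s t (A ∘ suc))) (sym (+-assoc (A 0) _ _))

sumTo-suc : ∀ s A → sumTo (suc s) A ≡ sumTo s A + A s
sumTo-suc zero    A = +-identityʳ (A 0)
sumTo-suc (suc s) A = trans (cong (A 0 +_) (sumTo-suc s (A ∘ suc))) (sym (+-assoc (A 0) _ _))

sumTo-mono : ∀ A {s t} → s ≤ t → sumTo s A ≤ sumTo t A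
sumTo-mono A {s} s≤t with m≤n⇒∃[o]m+o≡n s≤t
... | o , refl = subst (sumTo s A ≤_) (sym (sumTo-+ s o A)) (m≤m+n _ _)

sumTo-shift-≡⇒ : ∀ s A → sumTo s A ≡ sumTo s (A ∘ suc) → A 0 ≡ A s
sumTo-shift-≡⇒ zero    A shift≡ = refl
sumTo-shift-≡⇒ (suc s) A shift≡ = +-cancelʳ-≡ _ (A 0) (A (suc s))
  (trans shift≡ (trans (sumTo-suc s (A ∘ suc)) (+-comm _ (A (suc s)))))

sumTo-periodic : ∀ (A : ℕ → ℕ) d q ρ → (∀ t → t + d < q * d + ρ → A t ≡ A (t + d)) →
  sumTo (q * d + ρ) A ≡ q * sumTo d A + sumTo ρ A
sumTo-periodic A d zero    ρ periodic = refl
sumTo-periodic A d (suc q) ρ periodic = begin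
  sumTo (d + q * d + ρ) A                          ≡⟨ cong (λ l → sumTo l A) (+-assoc d (q * d) ρ) ⟩
  sumTo (d + (q * d + ρ)) A                        ≡⟨ sumTo-+ d (q * d + ρ) A ⟩
  sumTo d A + sumTo (q * d + ρ) (λ j → A (d + j))  ≡⟨ cong (sumTo d A +_) (sumTo-cong< (q * d + ρ) unshift) ⟩
  sumTo d A + sumTo (q * d + ρ) A                  ≡⟨ cong (sumTo d A +_) (sumTo-periodic A d q ρ periodic′) ⟩
  sumTo d A + (q * sumTo d A + sumTo ρ A)          ≡⟨ sym (+-assoc (sumTo d A) _ _) ⟩
  suc q * sumTo d A + sumTo ρ A                    ∎
  where
  open ≡-Reasoning
  rest≤ : q * d + ρ ≤ d + q * d + ρ
  rest≤ = subst (q * d + ρ ≤_) (sym (+-assoc d (q * d) ρ)) (m≤n+m (q * d + ρ) d)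
  periodic′ : ∀ t → t + d < q * d + ρ → A t ≡ A (t + d)
  periodic′ t t+d< = periodic t (<-≤-trans t+d< rest≤)
  unshift : ∀ j → j < q * d + ρ → A (d + j) ≡ A j
  unshift j j< = sym (trans (periodic j (<-≤-trans (+-monoˡ-< d j<) (≤-reflexive shuffle))) (cong A (+-comm j d)))
    where shuffle : q * d + ρ + d ≡ d + q * d + ρ
          shuffle = trans (+-comm (q * d + ρ) d) (sym (+-assoc d (q * d) ρ))

sumChoice : (m : ℕ) (n : Fin m → ℕ) → (Choice m n → ℕ) → ℕ
sumChoice zero    n g = g tt
sumChoice (suc m) n g = ∑[ j < n fzero ] sumChoice m (n ∘ fsuc) (λ c → g (j , c))

×-Fin↔ : ∀ {a b} {B : Set} → B ↔ Fin b → (Fin a × B) ↔ Fin (a * b)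
×-Fin↔ e = ↔-trans (↔-refl ×-↔ e) (↔-sym *↔×)

sum-×-Fin↔ : ∀ {a b} {B : Set} (e : B ↔ Fin b) (g : Fin a × B → ℕ) →
  sum (g ∘ from (×-Fin↔ {a} e)) ≡ ∑[ i < a ] ∑[ j < b ] g (i , from e j)
sum-×-Fin↔ {a} {b} e g = trans (sum-combine a b _)
  (sum-cong-≗ (λ i → sum-cong-≗ (λ j → cong (λ p → g (proj₁ p , from e (proj₂ p))) (remQuot-combine i j))))

Choice↔Fin : ∀ m n → Choice m n ↔ Fin (prod m n)
Choice↔Fin zero    n = ↔-sym 1↔⊤
Choice↔Fin (suc m) n = ×-Fin↔ (Choice↔Fin m (n ∘ fsuc))

sumChoice≡sum : ∀ m n (g : Choice m n → ℕ) → sumChoice m n g ≡ sum (g ∘ from (Choice↔Fin m n))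
sumChoice≡sum zero    n g = sym (+-identityʳ (g tt))
sumChoice≡sum (suc m) n g = sym (trans (sum-×-Fin↔ (Choice↔Fin m (n ∘ fsuc)) g)
  (sum-cong-≗ (λ i → sym (sumChoice≡sum m (n ∘ fsuc) (λ c → g (i , c))))))

sumChoice-cong : ∀ m n {f g : Choice m n → ℕ} → (∀ c → f c ≡ g c) → sumChoice m n f ≡ sumChoice m n g
sumChoice-cong zero    n f≡g = f≡g tt
sumChoice-cong (suc m) n f≡g = sum-cong-≗ (λ j → sumChoice-cong m (n ∘ fsuc) (λ c → f≡g (j , c)))

sumChoice-const : ∀ m n c → sumChoice m n (λ _ → c) ≡ prod m n * c
sumChoice-const m n c = trans (sumChoice≡sum m n (λ _ → c)) (sum-const (prod m n) c)

sumChoice-if : ∀ m n (b : Bool) (g : Choice m n → ℕ) →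
  sumChoice m n (λ c → if b then g c else 0) ≡ (if b then sumChoice m n g else 0)
sumChoice-if m n true  g = refl
sumChoice-if m n false g = trans (sumChoice≡sum m n (λ _ → 0)) (sum-replicate-zero (prod m n))

sumChoice-sumTo : ∀ m n d (H : ℕ → Choice m n → ℕ) →
  sumChoice m n (λ x → sumTo d (λ t → H t x)) ≡ sumTo d (λ t → sumChoice m n (H t))
sumChoice-sumTo m n d H = begin
  sumChoice m n (λ x → sumTo d (λ t → H t x))
    ≡⟨ sumChoice≡sum m n _ ⟩
  ∑[ i < prod m n ] ∑[ t < d ] H (toℕ t) (c i)
    ≡⟨ ∑-comm {prod m n} {d} (λ i t → H (toℕ t) (c i)) ⟩
  ∑[ t < d ] ∑[ i < prod m n ] H (toℕ t) (c i)
    ≡⟨ sum-cong-≗ {d} (λ t → sym (sumChoice≡sum m n (H (toℕ t)))) ⟩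
  sumTo d (λ t → sumChoice m n (H t)) ∎
  where
  open ≡-Reasoning
  c : Fin (prod m n) → Choice m n
  c = from (Choice↔Fin m n)

does-≟-sym : ∀ {m} (a b : Fin m) → does (a ≟ b) ≡ does (b ≟ a)
does-≟-sym a b with a ≟ b | b ≟ a
... | yes _   | yes _   = refl
... | yes a≡b | no  b≢a = ⊥-elim (b≢a (sym a≡b))
... | no  a≢b | yes b≡a = ⊥-elim (a≢b (sym b≡a))
... | no  _   | no  _   = refl

agree : ∀ {m n} → ℕ → Choice m n → Choice m n → ℕ
agree {zero}  u       c       x       = 1
agree {suc m} zero    (j , _) (y , _) = indicator (does (y ≟ j))
agree {suc m} (suc u) (j , c) (y , x) = if does (y ≟ j) then agree u c x else 0

agree-sym : ∀ {m n} u (c x : Choice m n) → agree u c x ≡ agree u x c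
agree-sym {zero}  u       c       x       = refl
agree-sym {suc m} zero    (j , _) (y , _) = cong indicator (does-≟-sym y j)
agree-sym {suc m} (suc u) (j , c) (y , x) with y ≟ j | j ≟ y
... | yes _   | yes _   = agree-sym u c x
... | yes y≡j | no  j≢y = ⊥-elim (j≢y (sym y≡j))
... | no  y≢j | yes j≡y = ⊥-elim (y≢j (sym j≡y))
... | no  _   | no  _   = refl

agree-cong : ∀ {m n} u (c c′ x : Choice m n) → (∀ i → toℕ i ≤ u → pick c i ≡ pick c′ i) →
  agree u c x ≡ agree u c′ x
agree-cong {zero}  u       c       c′        x       c≈c′ = refl
agree-cong {suc m} zero    (j , c) (j′ , c′) (y , x) c≈c′ with refl ← c≈c′ fzero z≤n = refl
agree-cong {suc m} (suc u) (j , c) (j′ , c′) (y , x) c≈c′ with refl ← c≈c′ fzero z≤n =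
  cong (λ a → if does (y ≟ j) then a else 0) (agree-cong u c c′ x (λ i i≤u → c≈c′ (fsuc i) (s≤s i≤u)))

prodAbove : (m : ℕ) → (Fin m → ℕ) → ℕ → ℕ
prodAbove m n u = prod m (λ j → if u <ᵇ toℕ j then n j else 1)

sumChoice-agree : ∀ m n u (x : Choice m n) → sumChoice m n (λ c → agree u c x) ≡ prodAbove m n u
sumChoice-agree zero    n u       x       = refl
sumChoice-agree (suc m) n zero    (y , x) = begin
  ∑[ j < n fzero ] sumChoice m (n ∘ fsuc) (λ _ → indicator (does (y ≟ j)))
    ≡⟨ sum-cong-≗ (λ j → sumChoice-if m (n ∘ fsuc) (does (y ≟ j)) (λ _ → 1)) ⟩
  ∑[ j < n fzero ] (if does (y ≟ j) then sumChoice m (n ∘ fsuc) (λ _ → 1) else 0)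
    ≡⟨ sum-if-≟ y _ ⟩
  sumChoice m (n ∘ fsuc) (λ _ → 1)
    ≡⟨ trans (sumChoice-const m (n ∘ fsuc) 1) (*-identityʳ _) ⟩
  prod m (n ∘ fsuc)
    ≡⟨ sym (+-identityʳ _) ⟩
  prodAbove (suc m) n zero ∎
  where open ≡-Reasoning
sumChoice-agree (suc m) n (suc u) (y , x) = begin
  ∑[ j < n fzero ] sumChoice m (n ∘ fsuc) (λ c → if does (y ≟ j) then agree u c x else 0)
    ≡⟨ sum-cong-≗ (λ j → sumChoice-if m (n ∘ fsuc) (does (y ≟ j)) (λ c → agree u c x)) ⟩
  ∑[ j < n fzero ] (if does (y ≟ j) then sumChoice m (n ∘ fsuc) (λ c → agree u c x) else 0)
    ≡⟨ sum-if-≟ y _ ⟩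
  sumChoice m (n ∘ fsuc) (λ c → agree u c x)
    ≡⟨ sumChoice-agree m (n ∘ fsuc) u x ⟩
  prodAbove m (n ∘ fsuc) u
    ≡⟨ sym (+-identityʳ _) ⟩
  prodAbove (suc m) n (suc u) ∎
  where open ≡-Reasoning

prod-split : ∀ m (n : Fin m → ℕ) a u → u < m → (∀ j → toℕ j ≤ u → n j ≡ a) →
  prod m n ≡ a ^ suc u * prodAbove m n u
prod-split (suc m) n a zero    _         n≡a =
  trans (cong (_* prod m (n ∘ fsuc)) (n≡a fzero z≤n)) (shape a (prod m (n ∘ fsuc)))
  where shape : ∀ a p → a * p ≡ (a * 1) * (1 * p)
        shape = solve-∀
prod-split (suc m) n a (suc u) (s<s u<m) n≡a =
  trans (cong₂ _*_ (n≡a fzero z≤n) (prod-split m (n ∘ fsuc) a u u<m (λ j j≤u → n≡a (fsuc j) (s≤s j≤u))))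
        (shape a (a ^ suc u) (prodAbove m (n ∘ fsuc) u))
  where shape : ∀ a b p → a * (b * p) ≡ (a * b) * (1 * p)
        shape = solve-∀

prod-positive : ∀ m (f : Fin m → ℕ) → (∀ j → 1 ≤ f j) → 1 ≤ prod m f
prod-positive zero    f f≥1 = s≤s z≤n
prod-positive (suc m) f f≥1 = *-mono-≤ (f≥1 fzero) (prod-positive m (f ∘ fsuc) (f≥1 ∘ fsuc))

sum-reindex : ∀ {A : Set} {a b} (e₁ : A ↔ Fin a) (e₂ : A ↔ Fin b) (g : A → ℕ) →
  sum (g ∘ from e₁) ≡ sum (g ∘ from e₂)
sum-reindex e₁ e₂ g = trans
  (sum-cong-≗ (λ i → cong g (sym (Inverse.strictlyInverseʳ e₂ (from e₁ i)))))
  (sym (sum-permute (g ∘ from e₂) (↔-trans (↔-sym e₁) e₂)))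

Edge↔Fin : ∀ lam m n → (Choice m n × Fin lam) ↔ Fin (lam * prod m n)
Edge↔Fin lam m n = ↔-trans (×-comm _ _) (×-Fin↔ (Choice↔Fin m n))

sum-Edge↔Fin : ∀ lam m n (g : Choice m n × Fin lam → ℕ) →
  sum (g ∘ from (Edge↔Fin lam m n)) ≡ ∑[ l < lam ] sumChoice m n (λ c → g (c , l))
sum-Edge↔Fin lam m n g = trans (sum-×-Fin↔ (Choice↔Fin m n) (λ p → g (proj₂ p , proj₁ p)))
  (sum-cong-≗ (λ l → sym (sumChoice≡sum m n (λ c → g (c , l)))))

sumChoice-straddles-average : ∀ m n .{{_ : NonZero (prod m n)}} D R (g : Choice m n → ℕ) →
  D * sumChoice m n g ≡ prod m n * R → ¬ D ∣ R → (∃ λ x → R div D < g x) × (∃ λ x → g x ≤ R div D)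
sumChoice-straddles-average m n D R g D*sum≡ D∤R
  with (v , above) , (w , below) ← sum-straddles-average D R (g ∘ from (Choice↔Fin m n))
                                     (trans (cong (D *_) (sym (sumChoice≡sum m n g))) D*sum≡) D∤R
  = (from (Choice↔Fin m n) v , above) , (from (Choice↔Fin m n) w , below)

module Positions (H : Hypergraph) {ε : ℕ} .{{_ : NonZero ε}} (ℓ : Edge H ⤖ Fin ε) where

  open Inverse (⤖⇒↔ ℓ) using (to; strictlyInverseˡ) renaming (from to ℓ⁻¹)

  position : ℕ → Fin ε
  position m = fromℕ< (m%n<n m ε)

  edgeAt : ℕ → Edge H
  edgeAt m = ℓ⁻¹ (position m)

  ℓ-edgeAt : ∀ m → toℕ (to (edgeAt m)) ≡ m % ε
  ℓ-edgeAt m = trans (cong toℕ (strictlyInverseˡ (position m))) (toℕ-fromℕ< _)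

  edgeAt-cong-% : ∀ {m m′} → m % ε ≡ m′ % ε → edgeAt m ≡ edgeAt m′
  edgeAt-cong-% m≡m′ =
    cong ℓ⁻¹ (toℕ-injective (trans (toℕ-fromℕ< _) (trans m≡m′ (sym (toℕ-fromℕ< _)))))

  sum-ℓ⁻¹≡sumTo-edgeAt : ∀ (g : Edge H → ℕ) → sum (g ∘ ℓ⁻¹) ≡ sumTo ε (g ∘ edgeAt)
  sum-ℓ⁻¹≡sumTo-edgeAt g = sum-cong-≗ (λ t → cong (g ∘ ℓ⁻¹) (toℕ-injective
    (sym (trans (toℕ-fromℕ< _) (m<n⇒m%n≡m (toℕ<n t))))))

  window : (s t : ℕ) → Fin s → Edge H
  window s t j = edgeAt (t + toℕ j)

  window-consecutive : ∀ s q d t → s ≡ q * ε + d → 1 ≤ d → t + d ≤ ε →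
    Consecutive H (ε , ℓ) s (window s t)
  window-consecutive zero    _ _ _ _  _   _     = tt
  window-consecutive (suc s) q d t s≡ d≥1 t+d≤ε = cyclic , fits
    where
    t<ε : t < ε
    t<ε = <-≤-trans (subst (_< t + d) (+-identityʳ t) (+-monoʳ-< t d≥1)) t+d≤ε
    ℓ₀ : toℕ (to (edgeAt (t + 0))) ≡ t
    ℓ₀ = trans (ℓ-edgeAt (t + 0)) (trans (cong (_% ε) (+-identityʳ t)) (m<n⇒m%n≡m t<ε))
    cyclic : ∀ (i : Fin (suc s)) →
      ∃ λ k → toℕ (to (edgeAt (t + 0))) + toℕ i ≡ k * ε + toℕ (to (edgeAt (t + toℕ i)))
    cyclic i = p / ε , (begin
      toℕ (to (edgeAt (t + 0))) + toℕ i  ≡⟨ cong (_+ toℕ i) ℓ₀ ⟩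
      p                                  ≡⟨ m≡m%n+[m/n]*n p ε ⟩
      p % ε + p / ε * ε                  ≡⟨ +-comm (p % ε) _ ⟩
      p / ε * ε + p % ε                  ≡⟨ cong (p / ε * ε +_) (sym (ℓ-edgeAt p)) ⟩
      p / ε * ε + toℕ (to (edgeAt p))    ∎)
      where
      open ≡-Reasoning
      p = t + toℕ i
    fits : ∀ a → a * ε ≤ suc s → suc s < suc a * ε → toℕ (to (edgeAt (t + 0))) ≤ suc a * ε ∸ suc s
    fits a _ s<[1+a]ε = subst (_≤ suc a * ε ∸ suc s) (sym ℓ₀) (m+n≤o⇒m≤o∸n t t+s≤)
      where
      q≤a : q ≤ a
      q≤a with q ≤? a
      ... | yes q≤a = q≤a
      ... | no  q≰a = ⊥-elim (<⇒≱ s<[1+a]ε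
        (≤-trans (*-monoˡ-≤ ε (≰⇒> q≰a)) (subst (q * ε ≤_) (sym s≡) (m≤m+n (q * ε) d))))
      t+s≤ : t + suc s ≤ suc a * ε
      t+s≤ = begin
        t + suc s        ≡⟨ cong (t +_) s≡ ⟩
        t + (q * ε + d)  ≡⟨ shuffle t (q * ε) d ⟩
        q * ε + (t + d)  ≤⟨ +-mono-≤ (*-monoˡ-≤ ε q≤a) t+d≤ε ⟩
        a * ε + ε        ≡⟨ +-comm (a * ε) ε ⟩
        suc a * ε        ∎
        where
        open ≤-Reasoning
        shuffle : ∀ x y z → x + (y + z) ≡ y + (x + z)
        shuffle = solve-∀

indicator-≟-≡⇒≡ : ∀ {m} (a b : Fin m) → indicator (does (a ≟ b)) ≡ indicator (does (b ≟ b)) → a ≡ b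
indicator-≟-≡⇒≡ a b eq with a ≟ b | b ≟ b
... | yes a≡b | _       = a≡b
... | no  _   | yes _   = case eq of λ ()
... | no  _   | no  b≢b = ⊥-elim (b≢b refl)

ordering-length : ∀ lam m n {ε} → (Choice m n × Fin lam) ⤖ Fin ε → ε ≡ lam * prod m n
ordering-length lam m n {ε} ℓ = begin
  ε                               ≡⟨ sym (*-identityʳ ε) ⟩
  ε * 1                           ≡⟨ sym (sum-const ε 1) ⟩
  sum {ε} (λ _ → 1)               ≡⟨ sum-reindex (⤖⇒↔ ℓ) (Edge↔Fin lam m n) (λ _ → 1) ⟩
  sum {lam * prod m n} (λ _ → 1)  ≡⟨ sum-const (lam * prod m n) 1 ⟩
  lam * prod m n * 1              ≡⟨ *-identityʳ _ ⟩
  lam * prod m n                  ∎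
  where open ≡-Reasoning

module _ (lam m : ℕ) (n : Fin m → ℕ) {ε : ℕ} .{{_ : NonZero ε}} (ℓ : (Choice m n × Fin lam) ⤖ Fin ε) where

  open Positions (blowup lam (K m n)) ℓ
  open Inverse (⤖⇒↔ ℓ) using () renaming (from to ℓ⁻¹)

  sum-ordering : ∀ (g : Choice m n × Fin lam → ℕ) →
    sumTo ε (g ∘ edgeAt) ≡ ∑[ l < lam ] sumChoice m n (λ c → g (c , l))
  sum-ordering g = begin
    sumTo ε (g ∘ edgeAt)                          ≡⟨ sym (sum-ℓ⁻¹≡sumTo-edgeAt g) ⟩
    sum (g ∘ ℓ⁻¹)                                 ≡⟨ sum-reindex (⤖⇒↔ ℓ) (Edge↔Fin lam m n) g ⟩
    sum (g ∘ from (Edge↔Fin lam m n))             ≡⟨ sum-Edge↔Fin lam m n g ⟩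
    ∑[ l < lam ] sumChoice m n (λ c → g (c , l))  ∎
    where open ≡-Reasoning

  pickAt : (i : Fin m) → ℕ → Fin (n i)
  pickAt i t = pick (proj₁ (edgeAt t)) i

  module _ {r s q d : ℕ} (good : GoodLen (blowup lam (K m n)) (ε , ℓ) r s)
           (s≡ : s ≡ q * ε + d) (d≥1 : 1 ≤ d) (i : Fin m) (balanced : n i * r ≡ s) where

    window-degree≡ : ∀ t → t + d ≤ ε → ∀ v →
      degree (blowup lam (K m n)) s (window s t) (i , v) ≡ r
    window-degree≡ t t+d≤ε = sum≡*⇒≡ r (λ v → degree (blowup lam (K m n)) s (window s t) (i , v))
      (λ v → good (window s t) (window-consecutive s q d t s≡ d≥1 t+d≤ε) (i , v))
      (trans (∑-count-≟ s (λ j → pickAt i (t + toℕ j))) (sym balanced))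

    pickAt-periodic : ∀ t → suc t + d ≤ ε → pickAt i t ≡ pickAt i (t + d)
    pickAt-periodic t 1+t+d≤ε = sym (indicator-≟-≡⇒≡ (pickAt i (t + d)) (pickAt i t) (begin
      hit (t + d)  ≡⟨ cong hitEdge wrap ⟩
      hit (t + s)  ≡⟨ sym (sumTo-shift-≡⇒ s (λ j → hit (t + j)) same-window-sums) ⟩
      hit (t + 0)  ≡⟨ cong hit (+-identityʳ t) ⟩
      hit t        ∎))
      where
      open ≡-Reasoning
      hitEdge : Choice m n × Fin lam → ℕ
      hitEdge e = indicator (does (pick (proj₁ e) i ≟ pickAt i t))
      hit : ℕ → ℕ
      hit = hitEdge ∘ edgeAt
      occurs : ℕ → Fin s → Bool
      occurs t′ j = does (pickAt i (t′ + toℕ j) ≟ pickAt i t)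
      wrap : edgeAt (t + d) ≡ edgeAt (t + s)
      wrap = edgeAt-cong-% (sym (trans (cong (_% ε) t+s≡) ([m+kn]%n≡m%n (t + d) q ε)))
        where t+s≡ : t + s ≡ t + d + q * ε
              t+s≡ = trans (cong (t +_) s≡) (shuffle t (q * ε) d)
                where shuffle : ∀ x y z → x + (y + z) ≡ x + z + y
                      shuffle = solve-∀
      t+d≤ε : t + d ≤ ε
      t+d≤ε = ≤-trans (n≤1+n (t + d)) 1+t+d≤ε
      same-window-sums : sumTo s (λ j → hit (t + j)) ≡ sumTo s (λ j → hit (t + suc j))
      same-window-sums = begin
        sumTo s (λ j → hit (t + j))      ≡⟨ sym (count≡sum s (occurs t)) ⟩
        count s (occurs t)               ≡⟨ window-degree≡ t t+d≤ε (pickAt i t) ⟩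
        r                                ≡⟨ sym (window-degree≡ (suc t) 1+t+d≤ε (pickAt i t)) ⟩
        count s (occurs (suc t))         ≡⟨ count≡sum s (occurs (suc t)) ⟩
        sumTo s (λ j → hit (suc t + j))  ≡⟨ sumTo-cong< s (λ j _ → cong hit (sym (+-suc t j))) ⟩
        sumTo s (λ j → hit (t + suc j))  ∎

  agreeAt : ℕ → Choice m n → ℕ → ℕ
  agreeAt u x t = agree u (proj₁ (edgeAt t)) x

  sumTo-agreeAt : ∀ u x → sumTo ε (agreeAt u x) ≡ lam * prodAbove m n u
  sumTo-agreeAt u x = begin
    sumTo ε (agreeAt u x)
      ≡⟨ sum-ordering (λ e → agree u (proj₁ e) x) ⟩
    ∑[ l < lam ] sumChoice m n (λ c → agree u c x)
      ≡⟨ sum-cong-≗ {lam} (λ _ → sumChoice-agree m n u x) ⟩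
    ∑[ l < lam ] prodAbove m n u
      ≡⟨ sum-const lam _ ⟩
    lam * prodAbove m n u ∎
    where open ≡-Reasoning

  sumChoice-agreeAt : ∀ u d → sumChoice m n (λ x → sumTo d (agreeAt u x)) ≡ d * prodAbove m n u
  sumChoice-agreeAt u d = begin
    sumChoice m n (λ x → sumTo d (agreeAt u x))
      ≡⟨ sumChoice-sumTo m n d (λ t x → agreeAt u x t) ⟩
    sumTo d (λ t → sumChoice m n (λ x → agree u (proj₁ (edgeAt t)) x))
      ≡⟨ sum-cong-≗ {d} (λ t → agreed (proj₁ (edgeAt (toℕ t)))) ⟩
    sumTo d (λ _ → prodAbove m n u)
      ≡⟨ sum-const d _ ⟩
    d * prodAbove m n u ∎
    where
    open ≡-Reasoning
    agreed : ∀ c → sumChoice m n (λ x → agree u c x) ≡ prodAbove m n u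
    agreed c = trans (sumChoice-cong m n (agree-sym u c)) (sumChoice-agree m n u c)

  sumTo-agreeAt-periodic : ∀ u d q ρ → ε ≡ q * d + ρ →
    (∀ t → suc t + d ≤ ε → ∀ i → toℕ i ≤ u → pickAt i t ≡ pickAt i (t + d)) →
    ∀ x → lam * prodAbove m n u ≡ q * sumTo d (agreeAt u x) + sumTo ρ (agreeAt u x)
  sumTo-agreeAt-periodic u d q ρ ε≡ prefix-periodic x = begin
    lam * prodAbove m n u                                  ≡⟨ sym (sumTo-agreeAt u x) ⟩
    sumTo ε (agreeAt u x)                                  ≡⟨ cong (λ l → sumTo l (agreeAt u x)) ε≡ ⟩
    sumTo (q * d + ρ) (agreeAt u x)                        ≡⟨ sumTo-periodic (agreeAt u x) d q ρ periodic ⟩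
    q * sumTo d (agreeAt u x) + sumTo ρ (agreeAt u x)      ∎
    where
    open ≡-Reasoning
    periodic : ∀ t → t + d < q * d + ρ → agreeAt u x t ≡ agreeAt u x (t + d)
    periodic t t+d< = agree-cong u _ _ x (prefix-periodic t (subst (suc t + d ≤_) (sym ε≡) t+d<))

quotient-lower : ∀ {T q c c′ M} → T ≡ q * c + c′ → M < c → (M + 1) * q ≤ T
quotient-lower {T} {q} {c} {c′} {M} T≡ M<c = begin
  (M + 1) * q  ≡⟨ shape M q ⟩
  q * suc M    ≤⟨ *-monoʳ-≤ q M<c ⟩
  q * c        ≤⟨ m≤m+n (q * c) c′ ⟩
  q * c + c′   ≡⟨ sym T≡ ⟩
  T            ∎
  where
  open ≤-Reasoning
  shape : ∀ M q → (M + 1) * q ≡ q * suc M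
  shape = solve-∀

quotient-upper : ∀ {T q c c′ M} → T ≡ q * c + c′ → c′ ≤ c → c ≤ M → T ≤ M * (q + 1)
quotient-upper {T} {q} {c} {c′} {M} T≡ c′≤c c≤M = begin
  T            ≡⟨ T≡ ⟩
  q * c + c′   ≤⟨ +-mono-≤ (*-monoʳ-≤ q c≤M) (≤-trans c′≤c c≤M) ⟩
  q * M + M    ≡⟨ shape q M ⟩
  M * (q + 1)  ∎
  where
  open ≤-Reasoning
  shape : ∀ q M → q * M + M ≡ M * (q + 1)
  shape = solve-∀

scaled-div-mod : ∀ a L R .{{_ : NonZero R}} → a * L ≡ L / R * (R * a) + L % R * a
scaled-div-mod a L R = trans (cong (a *_) (m≡m%n+[m/n]*n L R)) (shape a (L % R) (L / R) R)
  where shape : ∀ a ρ q R → a * (ρ + q * R) ≡ q * (R * a) + ρ * a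
        shape = solve-∀

module Setting (lam k : ℕ) (n : Fin (suc k) → ℕ) (n₀≥1 : 1 ≤ n fzero)
               (mono : (i j : Fin (suc k)) → toℕ i ≤ toℕ j → n i ≤ n j)
               (u : Fin (suc k)) (nᵤ≡n₀ : n u ≡ n fzero) where

  λK : Hypergraph
  λK = blowup lam (K (suc k) n)

  -- n₀ and D are the paper's n₁ and n₁^{u-1}: parts are indexed from 0 here.
  n₀ N L D N′ : ℕ
  n₀ = n fzero
  N  = prod k (n ∘ fsuc)
  L  = lam * N
  D  = n₀ ^ toℕ u
  N′ = prodAbove (suc k) n (toℕ u)

  n-positive : ∀ j → 1 ≤ n j
  n-positive j = ≤-trans n₀≥1 (mono fzero j z≤n)

  n-prefix : ∀ j → toℕ j ≤ toℕ u → n j ≡ n₀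
  n-prefix j j≤u = ≤-antisym (subst (n j ≤_) nᵤ≡n₀ (mono j u j≤u)) (mono fzero j z≤n)

  instance
    prod-nonZero : NonZero (prod (suc k) n)
    prod-nonZero = >-nonZero (prod-positive (suc k) n n-positive)

  module Ordered {ε} .{{_ : NonZero ε}} (ℓ : Edge λK ⤖ Fin ε) (r₁ R : ℕ)
                 (good : GoodLen λK (ε , ℓ) (r₁ * L + suc R) ((r₁ * L + suc R) * n₀)) where

    r₂ d q ρ : ℕ
    r₂ = suc R
    d  = r₂ * n₀
    q  = L / r₂
    ρ  = L % r₂ * n₀

    prefixHits : ℕ → Choice (suc k) n → ℕ
    prefixHits l x = sumTo l (agreeAt lam (suc k) n ℓ (toℕ u) x)

    ε≡ : ε ≡ lam * (n₀ * N)
    ε≡ = ordering-length lam (suc k) n ℓ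

    s≡ : (r₁ * L + r₂) * n₀ ≡ r₁ * ε + d
    s≡ = trans (shape r₁ lam N r₂ n₀) (cong (λ e → r₁ * e + d) (sym ε≡))
      where shape : ∀ r₁ lam N r₂ n₀ → (r₁ * (lam * N) + r₂) * n₀ ≡ r₁ * (lam * (n₀ * N)) + r₂ * n₀
            shape = solve-∀

    ε≡qd+ρ : ε ≡ q * d + ρ
    ε≡qd+ρ = trans ε≡ (trans (shape lam n₀ N) (scaled-div-mod n₀ L r₂))
      where shape : ∀ lam n₀ N → lam * (n₀ * N) ≡ n₀ * (lam * N)
            shape = solve-∀

    prefix-periodic : ∀ t → suc t + d ≤ ε → ∀ i → toℕ i ≤ toℕ u →
      pickAt lam (suc k) n ℓ i t ≡ pickAt lam (suc k) n ℓ i (t + d)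
    prefix-periodic t 1+t+d≤ε i i≤u =
      pickAt-periodic lam (suc k) n ℓ {r₁ * L + r₂} {(r₁ * L + r₂) * n₀} {r₁} {d} good s≡
        (*-mono-≤ {1} {r₂} (s≤s z≤n) n₀≥1) i
        (trans (cong (_* (r₁ * L + r₂)) (n-prefix i i≤u)) (*-comm n₀ (r₁ * L + r₂))) t 1+t+d≤ε

    prefixHits-split : ∀ x → lam * N′ ≡ q * prefixHits d x + prefixHits ρ x
    prefixHits-split = sumTo-agreeAt-periodic lam (suc k) n ℓ (toℕ u) d q ρ ε≡qd+ρ prefix-periodic

    prefixHits-rest≤ : ∀ x → prefixHits ρ x ≤ prefixHits d x
    prefixHits-rest≤ x = sumTo-mono (agreeAt lam (suc k) n ℓ (toℕ u) x) (*-monoˡ-≤ n₀ (<⇒≤ (m%n<n L r₂)))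

    prefixHits-average : D * sumChoice (suc k) n (prefixHits d) ≡ prod (suc k) n * r₂
    prefixHits-average = trans (cong (D *_) (sumChoice-agreeAt lam (suc k) n ℓ (toℕ u) d))
      (trans (shape D r₂ n₀ N′) (cong (_* r₂) (sym (prod-split (suc k) n n₀ (toℕ u) (toℕ<n u) n-prefix))))
      where shape : ∀ D r₂ n₀ N′ → D * (r₂ * n₀ * N′) ≡ n₀ * D * N′ * r₂
            shape = solve-∀

    bounds : ¬ D ∣ r₂ →
      1 ≤ r₂ × (r₂ div D + 1) * (L div r₂) ≤ lam * N′ × lam * N′ ≤ (r₂ div D) * (L div r₂ + 1)
    bounds D∤r₂
      with (x₊ , above) , (x₋ , below) ←
             sumChoice-straddles-average (suc k) n D r₂ (prefixHits d) prefixHits-average D∤r₂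
      = s≤s z≤n , quotient-lower (prefixHits-split x₊) above
                , quotient-upper (prefixHits-split x₋) (prefixHits-rest≤ x₋) below

  ¬∣⇒bounds : 1 ≤ lam → ∀ r₁ r₂ (o : Ordering λK) →
    GoodLen λK o (r₁ * L + r₂) ((r₁ * L + r₂) * n₀) → ¬ D ∣ r₂ →
    1 ≤ r₂ × (r₂ div D + 1) * (L div r₂) ≤ lam * N′ × lam * N′ ≤ (r₂ div D) * (L div r₂ + 1)
  ¬∣⇒bounds _     _  zero    _       _    D∤0 = ⊥-elim (D∤0 (D ∣0))
  ¬∣⇒bounds lam≥1 r₁ (suc R) (ε , ℓ) good = Ordered.bounds ℓ r₁ R good
    where
    instance
      ε-nonZero : NonZero ε
      ε-nonZero = >-nonZero (subst (1 ≤_) (sym (ordering-length lam (suc k) n ℓ))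
                                   (*-mono-≤ lam≥1 (prod-positive (suc k) n n-positive)))

lemma3p2 : (lam k : ℕ) (n : Fin (suc k) → ℕ) →
    1 ≤ lam → 1 ≤ n fzero →
    ((i j : Fin (suc k)) → toℕ i ≤ toℕ j → n i ≤ n j) →
    (u : Fin (suc k)) → n u ≡ n fzero →
    ((j : Fin (suc k)) → toℕ u < toℕ j → n j ≢ n fzero) →
    (r₁ r₂ : ℕ) →
    r₂ < lam * prod k (λ i → n (fsuc i)) →
    MsEq (blowup lam (K (suc k) n))
      (r₁ * (lam * prod k (λ i → n (fsuc i))) + r₂)
      ((r₁ * (lam * prod k (λ i → n (fsuc i))) + r₂) * n fzero) →
    (n fzero ^ toℕ u ∣ r₂)
    ⊎ (1 ≤ r₂
       × ((r₂ div (n fzero ^ toℕ u)) + 1) * ((lam * prod k (λ i → n (fsuc i))) div r₂)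
           ≤ lam * prod (suc k) (λ j → if toℕ u <ᵇ toℕ j then n j else 1)
       × lam * prod (suc k) (λ j → if toℕ u <ᵇ toℕ j then n j else 1)
           ≤ (r₂ div (n fzero ^ toℕ u)) * (((lam * prod k (λ i → n (fsuc i))) div r₂) + 1))
lemma3p2 lam k n lam≥1 n₀≥1 mono u nᵤ≡n₀ _ r₁ r₂ _ ((o , good) , _) with n fzero ^ toℕ u ∣? r₂
... | yes D∣r₂ = inj₁ D∣r₂
... | no  D∤r₂ = inj₂ (¬∣⇒bounds lam≥1 r₁ r₂ o good D∤r₂)
  where open Setting lam k n n₀≥1 mono u nᵤ≡n₀
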